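{- Suppose that ${\cal S}$ is a sound local proposition epistemic protocol specification, and let ${\cal S}'$ be the knowledge-based program resulting from replacing each formula $AG(x \Rightarrow \kappa(x))$ in $\Phi$ by the formula $AG(x \Leftrightarrow \kappa(x))$. Then every implementation $\theta$ of ${\cal S}'$ is an implementation of ${\cal S}$.
   Context: An epistemic protocol specification ${\cal S}=\langle Ags, E, \{\mathtt{P}_i\}_{i\in Ags}, \Phi\rangle$ consists of agents, an environment $E$ (with states, initial states, actions $Acts_i$, transitions, observation functions $O_i$ and interpretation $\pi$), protocol templates $\mathtt{P}_i$ of the form $\mathbf{do}~\phi_1\rightarrow a_1~[]~\ldots~[]~\phi_k\rightarrow a_k~\mathbf{od}$ whose guards may contain boolean template variables, and a set $\Phi$ of CTLK formulas. An implementation is a substitution $\theta$ assigning to each template variable of agent $i$ a boolean formula local to agent $i$ such that the system $\mathcal{I}(E,\mathtt{P}\theta)$ generated by the concrete joint protocol satisfies $\Phi\theta$. The specification is a sound local proposition specification if $\Phi$ is given by a function $\kappa$ assigning to each template variable $x$ of agent $i$ a formula $\kappa(x)=K_i\psi$, with $\Phi=\{AG(x\Rightarrow\kappa(x))\}$ over all template variables $x$. -}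

module Defs where

open import Data.Nat using (ℕ; _<_)
open import Data.Fin using (Fin)
open import Data.Bool using (Bool; true; false; not; _∧_; _∨_)
open import Data.Empty using (⊥)
open import Data.Unit using () renaming (⊤ to Unit)
open import Data.Product using (Σ; _×_; _,_; proj₁; proj₂)
open import Data.Sum using (_⊎_)
open import Data.List using (List; map)
open import Data.List.Relation.Unary.Any using (Any)
open import Data.List.Relation.Unary.All using (All)
open import Relation.Binary.PropositionalEquality using (_≡_)

record Environment (n : ℕ) : Set₁ where
  field
    State : Set
    Init  : State → Set
    Act   : Fin n → Set
    -- the null action an agent performs when none of its guards holds
    skip  : (i : Fin n) → Act i
    δ     : State → ((i : Fin n) → Act i) → State → Set
    Obs   : Fin n → Set
    O     : (i : Fin n) → State → Obs i
    Atom  : Set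
    π     : State → Atom → Bool

data BF (P V : Set) : Set where
  atom : P → BF P V
  var  : V → BF P V
  tt ff : BF P V
  neg  : BF P V → BF P V
  and or : BF P V → BF P V → BF P V

substB : {P V W : Set} → (V → BF P W) → BF P V → BF P W
substB θ (atom p)  = atom p
substB θ (var v)   = θ v
substB θ tt        = tt
substB θ ff        = ff
substB θ (neg φ)   = neg (substB θ φ)
substB θ (and φ ψ) = and (substB θ φ) (substB θ ψ)
substB θ (or φ ψ)  = or (substB θ φ) (substB θ ψ)

evalB : {P : Set} → (P → Bool) → BF P ⊥ → Bool
evalB v (atom p)  = v p
evalB v (var ())
evalB v tt        = true
evalB v ff        = false
evalB v (neg φ)   = not (evalB v φ)
evalB v (and φ ψ) = evalB v φ ∧ evalB v ψ
evalB v (or φ ψ)  = evalB v φ ∨ evalB v ψ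

data Form (n : ℕ) (P V : Set) : Set where
  atom : P → Form n P V
  var  : V → Form n P V
  ⊤f ⊥f : Form n P V
  ¬f   : Form n P V → Form n P V
  _∧f_ _∨f_ _⇒f_ : Form n P V → Form n P V → Form n P V
  EX AX EG AG : Form n P V → Form n P V
  EU AU : Form n P V → Form n P V → Form n P V
  K    : Fin n → Form n P V → Form n P V

_⇔f_ : {n : ℕ} {P V : Set} → Form n P V → Form n P V → Form n P V
φ ⇔f ψ = (φ ⇒f ψ) ∧f (ψ ⇒f φ)

ofBF : {n : ℕ} {P W : Set} → BF P W → Form n P W
ofBF (atom p)  = atom p
ofBF (var v)   = var v
ofBF tt        = ⊤f
ofBF ff        = ⊥f
ofBF (neg φ)   = ¬f (ofBF φ)
ofBF (and φ ψ) = ofBF φ ∧f ofBF ψ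
ofBF (or φ ψ)  = ofBF φ ∨f ofBF ψ

substF : {n : ℕ} {P V W : Set} → (V → BF P W) → Form n P V → Form n P W
substF θ (atom p) = atom p
substF θ (var v)  = ofBF (θ v)
substF θ ⊤f       = ⊤f
substF θ ⊥f       = ⊥f
substF θ (¬f φ)   = ¬f (substF θ φ)
substF θ (φ ∧f ψ) = substF θ φ ∧f substF θ ψ
substF θ (φ ∨f ψ) = substF θ φ ∨f substF θ ψ
substF θ (φ ⇒f ψ) = substF θ φ ⇒f substF θ ψ
substF θ (EX φ)   = EX (substF θ φ)
substF θ (AX φ)   = AX (substF θ φ)
substF θ (EG φ)   = EG (substF θ φ)
substF θ (AG φ)   = AG (substF θ φ)
substF θ (EU φ ψ) = EU (substF θ φ) (substF θ ψ)
substF θ (AU φ ψ) = AU (substF θ φ) (substF θ ψ)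
substF θ (K i φ)  = K i (substF θ φ)

-- The system I(E, P) generated by a concrete joint protocol P
-- (agent i's protocol: do g₁ → a₁ [] … [] g_k → a_k od, as a list of
--  guarded actions with closed boolean guards).

module System {n : ℕ} (E : Environment n)
  (prot : (i : Fin n) → List (BF (Environment.Atom E) ⊥ × Environment.Act E i)) where
  open Environment E

  holds : State → BF Atom ⊥ → Bool
  holds s g = evalB (π s) g

  Enabled : (i : Fin n) → State → Act i → Set
  Enabled i s a =
    Any (λ ga → holds s (proj₁ ga) ≡ true × proj₂ ga ≡ a) (prot i)
    ⊎ (All (λ ga → holds s (proj₁ ga) ≡ false) (prot i) × a ≡ skip i)

  Step : State → State → Set
  Step s t = Σ ((i : Fin n) → Act i) λ a →
    ((i : Fin n) → Enabled i s (a i)) × δ s a t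

  data Reach : State → Set where
    init : ∀ {s} → Init s → Reach s
    step : ∀ {s t} → Reach s → Step s t → Reach t

  Path : State → Set
  Path s = Σ (ℕ → State) λ p → (p 0 ≡ s) × (∀ k → Step (p k) (p (Data.Nat.suc k)))

  sat : Form n Atom ⊥ → State → Set
  sat (atom p) s = π s p ≡ true
  sat (var ()) s
  sat ⊤f s       = Unit
  sat ⊥f s       = ⊥
  sat (¬f φ) s   = sat φ s → ⊥
  sat (φ ∧f ψ) s = sat φ s × sat ψ s
  sat (φ ∨f ψ) s = sat φ s ⊎ sat ψ s
  sat (φ ⇒f ψ) s = sat φ s → sat ψ s
  sat (EX φ) s   = Σ (Path s) λ p → sat φ (proj₁ p 1)
  sat (AX φ) s   = (p : Path s) → sat φ (proj₁ p 1)
  sat (EG φ) s   = Σ (Path s) λ p → ∀ k → sat φ (proj₁ p k)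
  sat (AG φ) s   = (p : Path s) → ∀ k → sat φ (proj₁ p k)
  sat (EU φ ψ) s = Σ (Path s) λ p → Σ ℕ λ k →
                     sat ψ (proj₁ p k) × (∀ j → j < k → sat φ (proj₁ p j))
  sat (AU φ ψ) s = (p : Path s) → Σ ℕ λ k →
                     sat ψ (proj₁ p k) × (∀ j → j < k → sat φ (proj₁ p j))
  sat (K i φ) s  = ∀ t → Reach t → O i s ≡ O i t → sat φ t

  Valid : Form n Atom ⊥ → Set
  Valid φ = ∀ s → Init s → sat φ s

TVar : {n : ℕ} → (Fin n → Set) → Set
TVar {n} Var = Σ (Fin n) Var

record EPS (n : ℕ) : Set₁ where
  field
    env  : Environment n
    Var  : Fin n → Set
    templ : (i : Fin n) →
            List (BF (Environment.Atom env) (Var i) × Environment.Act env i)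
    Idx  : Set
    Φ    : Idx → Form n (Environment.Atom env) (TVar Var)

module _ {n : ℕ} (S : EPS n) where
  open EPS S
  open Environment env

  Substitution : Set
  Substitution = (i : Fin n) → Var i → BF Atom ⊥

  LocalSubst : Substitution → Set
  LocalSubst θ = ∀ i (x : Var i) s t → O i s ≡ O i t →
    evalB (π s) (θ i x) ≡ evalB (π t) (θ i x)

  θ-all : Substitution → TVar Var → BF Atom ⊥
  θ-all θ (i , x) = θ i x

  concrete : Substitution → (i : Fin n) → List (BF Atom ⊥ × Act i)
  concrete θ i = map (λ ga → substB (θ i) (proj₁ ga) , proj₂ ga) (templ i)

  IsImplementation : Substitution → Set
  IsImplementation θ = LocalSubst θ ×
    (∀ k → System.Valid env (concrete θ) (substF (θ-all θ) (Φ k)))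

record SLPSpec (n : ℕ) : Set₁ where
  field
    env  : Environment n
    Var  : Fin n → Set
    templ : (i : Fin n) →
            List (BF (Environment.Atom env) (Var i) × Environment.Act env i)
    ψ    : (i : Fin n) → Var i → Form n (Environment.Atom env) (TVar Var)

  κ : (i : Fin n) → Var i → Form n (Environment.Atom env) (TVar Var)
  κ i x = K i (ψ i x)

  spec : EPS n
  spec = record { env = env ; Var = Var ; templ = templ ; Idx = TVar Var
                ; Φ = λ { (i , x) → AG (var (i , x) ⇒f κ i x) } }

  kbp : EPS n
  kbp = record { env = env ; Var = Var ; templ = templ ; Idx = TVar Var
                ; Φ = λ { (i , x) → AG (var (i , x) ⇔f κ i x) } }

module Submission where

-- S and S' share the environment, the protocol templates and the index
-- set of Φ; for each template variable x they differ only in demanding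
-- AG (x ⇔ κ(x)) instead of AG (x ⇒ κ(x)).  Substitution acts on formulas
-- homomorphically, so after applying θ the two requirements are again
-- AG (θx ⇔ κθ) and AG (θx ⇒ κθ), interpreted in the SAME system
-- I(E, Pθ).  Hence the locality part of an implementation carries over
-- unchanged, and the validity part follows from the general fact that,
-- in any system, validity of AG (φ ⇔ ψ) entails validity of AG (φ ⇒ ψ)
-- (lemma valid-AG⇔⇒valid-AG⇒).  theorem3 combines the two observations.

open import Defs
open import Data.Nat using (ℕ)
open import Data.Fin using (Fin)
open import Data.Empty using (⊥)
open import Data.List using (List)
open import Data.Product using (_×_; _,_; proj₁)

valid-AG⇔⇒valid-AG⇒ :
  {n : ℕ} (E : Environment n)
  (prot : (i : Fin n) → List (BF (Environment.Atom E) ⊥ × Environment.Act E i))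
  (φ ψ : Form n (Environment.Atom E) ⊥) →
  System.Valid E prot (AG (φ ⇔f ψ)) → System.Valid E prot (AG (φ ⇒f ψ))
valid-AG⇔⇒valid-AG⇒ E prot φ ψ valid s init path k =
  proj₁ (valid s init path k)

-- The requirement on x in S' is, after substitution, exactly
-- AG (θx ⇔ κθ) (substF distributes over AG and ⇔f definitionally), while
-- the one in S is AG (θx ⇒ κθ); both live in the system I(E, Pθ).
theorem3 : {n : ℕ} (S : SLPSpec n) (θ : Substitution (SLPSpec.kbp S)) →
    IsImplementation (SLPSpec.kbp S) θ → IsImplementation (SLPSpec.spec S) θ
theorem3 S θ (local , valid) = local , λ { (i , x) →
  valid-AG⇔⇒valid-AG⇒ env (concrete kbp θ)
    (ofBF (θ i x)) (substF (θ-all kbp θ) (κ i x)) (valid (i , x)) }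
  where open SLPSpec S
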